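{- Let $\epsilon\in(0,\tfrac12]$, $\delta\in(0,1)$, $c=80/\delta$, $H=\{v\in V:\deg(v)\ge\epsilon^2m/c\}$, $L=V\setminus H$. Suppose $e(H,L)=\alpha\cdot\mathrm{OPT}$ with $\alpha<\tfrac12+\epsilon^2$, and $m>\frac{8c^2}{\epsilon^8}$. Then $\mathrm{OPT}_L>(1-\alpha-\epsilon^4)\mathrm{OPT}$, where $\mathrm{OPT}_L$ is the MAX-CUT value of the induced subgraph $G[L]$.
   Context: $G=(V,E)$ is an undirected, unweighted, simple graph with $m\ge1$ edges. $e(S,T)$ is the number of edges with one endpoint in $S$ and the other in $T$; $\mathrm{OPT}=\max_{S\subseteq V}e(S,V\setminus S)$ is the MAX-CUT value of $G$.
   Formalization: The parameters ε and δ take only rational values, within the intervals (0,½] and (0,1) respectively. -}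

module Defs where

open import Data.Nat as ℕ using (ℕ; zero; suc; _⊔_)
open import Data.Integer using (+_; +[1+_]; -[1+_])
open import Data.Bool using (Bool; true; false; if_then_else_; _∧_; not)
open import Data.Fin using (Fin; _<_)
open import Data.Fin.Properties using (_<?_)
open import Data.List using (List; []; _∷_; map; foldr; concatMap; filter; length)
open import Data.List using (allFin)
open import Data.Rational as ℚ using (ℚ; mkℚ; _÷_; 0ℚ; 1ℚ; _*_)
open import Relation.Nullary.Decidable using (⌊_⌋; does)
open import Relation.Binary.PropositionalEquality using (_≡_)

record Graph (n : ℕ) : Set where
  field
    adj   : Fin n → Fin n → Bool
    sym   : ∀ u v → adj u v ≡ adj v u
    irrefl : ∀ v → adj v v ≡ false
open Graph public

VSet : ℕ → Set
VSet n = Fin n → Bool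

countFin : (n : ℕ) → (Fin n → Bool) → ℕ
countFin n P = length (filter (λ i → Data.Bool._≟_ (P i) true) (allFin n))
  where import Data.Bool

countPairs : (n : ℕ) → (Fin n → Fin n → Bool) → ℕ
countPairs n P = foldr ℕ._+_ 0 (map (λ u → countFin n (P u)) (allFin n))

edges : ∀ {n} → Graph n → ℕ
edges {n} G = countPairs n (λ u v → adj G u v ∧ ⌊ u <? v ⌋)

deg : ∀ {n} → Graph n → Fin n → ℕ
deg {n} G v = countFin n (adj G v)

-- e(S , T): number of edges with one endpoint in S and the other in T
-- (counted as ordered pairs u ∈ S, v ∈ T; for disjoint S, T each such edge is counted once)
e : ∀ {n} → Graph n → VSet n → VSet n → ℕ
e {n} G S T = countPairs n (λ u v → adj G u v ∧ S u ∧ T v)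

complement : ∀ {n} → VSet n → VSet n
complement S v = not (S v)

intersect : ∀ {n} → VSet n → VSet n → VSet n
intersect S T v = S v ∧ T v

allSubsets : (n : ℕ) → List (VSet n)
allSubsets zero = (λ ()) ∷ []
allSubsets (suc n) =
  concatMap (λ S → (λ { Fin.zero → false ; (Fin.suc i) → S i })
                 ∷ (λ { Fin.zero → true ; (Fin.suc i) → S i }) ∷ [])
            (allSubsets n)
  where import Data.Fin as Fin

maximum : List ℕ → ℕ
maximum = foldr _⊔_ 0

OPT : ∀ {n} → Graph n → ℕ
OPT {n} G = maximum (map (λ S → e G S (complement S)) (allSubsets n))

-- OPT_L = MAX-CUT value of the induced subgraph G[L]
--       = max_{S ⊆ L} e(S , L ∖ S)   (edges of G[L] are the edges of G inside L)
OPT-induced : ∀ {n} → Graph n → VSet n → ℕ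
OPT-induced {n} G L =
  maximum (map (λ S → e G (intersect L S) (intersect L (complement S))) (allSubsets n))

ℕ→ℚ : ℕ → ℚ
ℕ→ℚ k = (+ k) ℚ./ 1

-- total division on ℚ (x / 0 := 0); only used with nonzero denominators
_/'_ : ℚ → ℚ → ℚ
p /' mkℚ (+ zero) _ _ = 0ℚ
p /' q@(mkℚ +[1+ _ ] _ _) = p ÷ q
p /' q@(mkℚ -[1+ _ ] _ _) = p ÷ q

_^_ : ℚ → ℕ → ℚ
x ^ zero = 1ℚ
x ^ suc k = x * (x ^ k)

H-set : ∀ {n} → Graph n → (ε c : ℚ) → VSet n
H-set G ε c v = ⌊ ((ε ^ 2) * ℕ→ℚ (edges G)) /' c ℚ.≤? ℕ→ℚ (deg G v) ⌋

{-# OPTIONS --safe #-}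
-- Averaging over all 2ⁿ subsets S, a pair (u , v) of adjacent vertices has u ∈ S ∌ v for a quarter
-- of them, so the average cut has m/2 edges and m ≤ 2·OPT. Since the degrees sum to 2m, at most
-- 2c/ε² vertices have degree ≥ ε²m/c, hence |H|² ≤ 4c²/ε⁴ < ε⁴m/2 ≤ ε⁴·OPT by the assumption on m.
-- Finally, a cut of G consists of a cut of G[L], edges between H and L (each crossing the cut in at
-- most one direction) and edges inside H, so OPT ≤ OPT_L + α·OPT + |H|².
module Submission where

open import Defs hiding (sym)

module Counting where

  open import Data.Bool.Base using (Bool; true; false; _∧_; not)
  import Data.Bool.Properties as Bool
  open import Data.Empty using (⊥-elim)
  import Data.Fin.Base as Fin
  open Fin using (Fin)
  open import Data.Fin.Properties using (_<?_; <-asym; toℕ-injective)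
  open import Data.List.Base using (List; []; _∷_; _++_; map; filter; length; concatMap; allFin)
  open import Data.Nat.Base as ℕ using (ℕ; zero; suc; _+_; _*_; _≤_; _⊔_; z≤n)
  open import Data.Nat.ListAction using (sum)
  open import Data.Nat.Properties hiding (_<?_; <-asym)
  open import Algebra.Properties.CommutativeSemigroup +-commutativeSemigroup
    using () renaming (interchange to +-interchange)
  open import Data.Nat.Tactic.RingSolver using (solve-∀)
  open import Function.Base using (_∘_)
  open import Relation.Binary.PropositionalEquality
    using (_≡_; _≢_; refl; sym; trans; cong; cong₂; module ≡-Reasoning)
  open import Relation.Nullary.Decidable using (Dec; yes; no; does; ⌊_⌋)

  ∑ : {A : Set} → List A → (A → ℕ) → ℕ
  ∑ xs f = sum (map f xs)

  syntax ∑ xs (λ x → f) = ∑[ x ∈ xs ] f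

  [_] : Bool → ℕ
  [ true ] = 1
  [ false ] = 0

  one-sided : ∀ b c → [ b ] ≡ [ b ∧ true ] + [ c ∧ false ]
  one-sided false false = refl
  one-sided false true = refl
  one-sided true false = refl
  one-sided true true = refl

  [∧]≡[]*[] : ∀ a b → [ a ∧ b ] ≡ [ a ] * [ b ]
  [∧]≡[]*[] false b = refl
  [∧]≡[]*[] true b = sym (+-identityʳ [ b ])

  cut-at-most-one-way : ∀ x su sv → [ x ∧ (su ∧ not sv) ] + [ x ∧ (sv ∧ not su) ] ≤ [ x ]
  cut-at-most-one-way false _ _ = z≤n
  cut-at-most-one-way true false false = z≤n
  cut-at-most-one-way true false true = ≤-refl
  cut-at-most-one-way true true false = ≤-refl
  cut-at-most-one-way true true true = z≤n

  classify-cut-pair : ∀ a hu hv su sv → [ a ∧ su ∧ not sv ] ≤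
    [ a ∧ (not hu ∧ su) ∧ (not hv ∧ not sv) ] +
    ([ (a ∧ hu ∧ not hv) ∧ (su ∧ not sv) ] + [ (a ∧ hv ∧ not hu) ∧ (su ∧ not sv) ] + [ hu ∧ hv ])
  classify-cut-pair false _ _ _ _ = z≤n
  classify-cut-pair true _ _ false _ = z≤n
  classify-cut-pair true _ _ true true = z≤n
  classify-cut-pair true false false true false = ≤-refl
  classify-cut-pair true false true true false = ≤-refl
  classify-cut-pair true true false true false = ≤-refl
  classify-cut-pair true true true true false = ≤-refl

  module _ {A : Set} where

    ∑-cong : ∀ xs {f g : A → ℕ} → (∀ x → f x ≡ g x) → ∑ xs f ≡ ∑ xs g
    ∑-cong [] f≡g = refl
    ∑-cong (x ∷ xs) f≡g = cong₂ _+_ (f≡g x) (∑-cong xs f≡g)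

    ∑-mono-≤ : ∀ xs {f g : A → ℕ} → (∀ x → f x ≤ g x) → ∑ xs f ≤ ∑ xs g
    ∑-mono-≤ [] f≤g = z≤n
    ∑-mono-≤ (x ∷ xs) f≤g = +-mono-≤ (f≤g x) (∑-mono-≤ xs f≤g)

    ∑-zero : ∀ (xs : List A) → ∑[ x ∈ xs ] 0 ≡ 0
    ∑-zero [] = refl
    ∑-zero (x ∷ xs) = ∑-zero xs

    ∑-distrib-+ : ∀ xs (f g : A → ℕ) → ∑[ x ∈ xs ] (f x + g x) ≡ ∑ xs f + ∑ xs g
    ∑-distrib-+ [] f g = refl
    ∑-distrib-+ (x ∷ xs) f g = trans (cong (f x + g x +_) (∑-distrib-+ xs f g))
      (+-interchange (f x) (g x) (∑ xs f) (∑ xs g))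

    *-distribˡ-∑ : ∀ xs k (f : A → ℕ) → k * ∑ xs f ≡ ∑[ x ∈ xs ] (k * f x)
    *-distribˡ-∑ [] k f = *-zeroʳ k
    *-distribˡ-∑ (x ∷ xs) k f =
      trans (*-distribˡ-+ k (f x) (∑ xs f)) (cong (k * f x +_) (*-distribˡ-∑ xs k f))

    ∑-++ : ∀ xs ys (f : A → ℕ) → ∑ (xs ++ ys) f ≡ ∑ xs f + ∑ ys f
    ∑-++ [] ys f = refl
    ∑-++ (x ∷ xs) ys f = trans (cong (f x +_) (∑-++ xs ys f)) (sym (+-assoc (f x) _ _))

    length≡∑1 : ∀ (xs : List A) → length xs ≡ ∑[ x ∈ xs ] 1
    length≡∑1 [] = refl
    length≡∑1 (x ∷ xs) = cong suc (length≡∑1 xs)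

    length-filter : ∀ {P : A → Set} (P? : ∀ x → Dec (P x)) xs →
      length (filter P? xs) ≡ ∑[ x ∈ xs ] [ does (P? x) ]
    length-filter P? [] = refl
    length-filter P? (x ∷ xs) with does (P? x)
    ... | true = cong suc (length-filter P? xs)
    ... | false = length-filter P? xs

    ∑≤maximum*length : ∀ xs (f : A → ℕ) → ∑ xs f ≤ maximum (map f xs) * length xs
    ∑≤maximum*length [] f = z≤n
    ∑≤maximum*length (x ∷ xs) f = begin
      f x + ∑ xs f
        ≤⟨ +-monoʳ-≤ (f x) (∑≤maximum*length xs f) ⟩
      f x + M * length xs
        ≤⟨ +-mono-≤ (m≤m⊔n (f x) M) (*-monoˡ-≤ (length xs) (m≤n⊔m (f x) M)) ⟩
      f x ⊔ M + (f x ⊔ M) * length xs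
        ≡⟨ *-suc (f x ⊔ M) (length xs) ⟨
      (f x ⊔ M) * suc (length xs) ∎
      where
      open ≤-Reasoning
      M = maximum (map f xs)

    maximum-mono-+ : ∀ xs {f g : A → ℕ} k → (∀ x → f x ≤ g x + k) →
      maximum (map f xs) ≤ maximum (map g xs) + k
    maximum-mono-+ [] k f≤g+k = z≤n
    maximum-mono-+ (x ∷ xs) {f} {g} k f≤g+k = ⊔-lub
      (≤-trans (f≤g+k x) (+-monoˡ-≤ k (m≤m⊔n (g x) _)))
      (≤-trans (maximum-mono-+ xs k f≤g+k) (+-monoˡ-≤ k (m≤n⊔m (g x) _)))

  module _ {A B : Set} where

    ∑-comm : ∀ xs ys (f : A → B → ℕ) →
      ∑[ x ∈ xs ] ∑[ y ∈ ys ] f x y ≡ ∑[ y ∈ ys ] ∑[ x ∈ xs ] f x y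
    ∑-comm [] ys f = sym (∑-zero ys)
    ∑-comm (x ∷ xs) ys f =
      trans (cong (∑ ys (f x) +_) (∑-comm xs ys f)) (sym (∑-distrib-+ ys (f x) _))

    ∑-concatMap : ∀ (g : A → List B) xs (f : B → ℕ) → ∑ (concatMap g xs) f ≡ ∑[ x ∈ xs ] ∑ (g x) f
    ∑-concatMap g [] f = refl
    ∑-concatMap g (x ∷ xs) f =
      trans (∑-++ (g x) (concatMap g xs) f) (cong (∑ (g x) f +_) (∑-concatMap g xs f))

  countFin≡∑ : ∀ n (P : Fin n → Bool) → countFin n P ≡ ∑[ i ∈ allFin n ] [ P i ]
  countFin≡∑ n P = trans (length-filter (λ i → P i Bool.≟ true) (allFin n))
                         (∑-cong (allFin n) (λ i → does-≟-true (P i)))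
    where
    does-≟-true : ∀ b → [ does (b Bool.≟ true) ] ≡ [ b ]
    does-≟-true true = refl
    does-≟-true false = refl

  ∑² : ∀ n → (Fin n → Fin n → ℕ) → ℕ
  ∑² n f = ∑[ u ∈ allFin n ] ∑[ v ∈ allFin n ] f u v

  countPairs≡∑² : ∀ n (P : Fin n → Fin n → Bool) → countPairs n P ≡ ∑² n (λ u v → [ P u v ])
  countPairs≡∑² n P = ∑-cong (allFin n) (λ u → countFin≡∑ n (P u))

  module _ (n : ℕ) where

    ∑²-cong : ∀ {f g : Fin n → Fin n → ℕ} → (∀ u v → f u v ≡ g u v) → ∑² n f ≡ ∑² n g
    ∑²-cong f≡g = ∑-cong (allFin n) (λ u → ∑-cong (allFin n) (f≡g u))

    ∑²-mono-≤ : ∀ {f g : Fin n → Fin n → ℕ} → (∀ u v → f u v ≤ g u v) → ∑² n f ≤ ∑² n g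
    ∑²-mono-≤ f≤g = ∑-mono-≤ (allFin n) (λ u → ∑-mono-≤ (allFin n) (f≤g u))

    ∑²-distrib-+ : ∀ (f g : Fin n → Fin n → ℕ) → ∑² n (λ u v → f u v + g u v) ≡ ∑² n f + ∑² n g
    ∑²-distrib-+ f g = trans (∑-cong (allFin n) (λ u → ∑-distrib-+ (allFin n) (f u) (g u)))
                             (∑-distrib-+ (allFin n) _ _)

    *-distribˡ-∑² : ∀ k (f : Fin n → Fin n → ℕ) → k * ∑² n f ≡ ∑² n (λ u v → k * f u v)
    *-distribˡ-∑² k f = trans (*-distribˡ-∑ (allFin n) k _)
                              (∑-cong (allFin n) (λ u → *-distribˡ-∑ (allFin n) k (f u)))

    ∑²-transpose : ∀ (f : Fin n → Fin n → ℕ) → ∑² n (λ u v → f v u) ≡ ∑² n f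
    ∑²-transpose f = ∑-comm (allFin n) (allFin n) (λ u v → f v u)

    ∑²-+-transpose : ∀ (f g : Fin n → Fin n → ℕ) →
      ∑² n (λ u v → f u v + g v u) ≡ ∑² n (λ u v → f u v + g u v)
    ∑²-+-transpose f g = begin
      ∑² n (λ u v → f u v + g v u) ≡⟨ ∑²-distrib-+ f (λ u v → g v u) ⟩
      ∑² n f + ∑² n (λ u v → g v u) ≡⟨ cong (∑² n f +_) (∑²-transpose g) ⟩
      ∑² n f + ∑² n g               ≡⟨ ∑²-distrib-+ f g ⟨
      ∑² n (λ u v → f u v + g u v) ∎
      where open ≡-Reasoning

    ∑²-product : ∀ (f g : Fin n → ℕ) → ∑² n (λ u v → f u * g v) ≡ ∑ (allFin n) f * ∑ (allFin n) g
    ∑²-product f g = begin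
      ∑[ u ∈ allFin n ] ∑[ v ∈ allFin n ] (f u * g v)
        ≡⟨ ∑-cong (allFin n) (λ u → *-distribˡ-∑ (allFin n) (f u) g) ⟨
      ∑[ u ∈ allFin n ] (f u * ∑ (allFin n) g)
        ≡⟨ ∑-cong (allFin n) (λ u → *-comm (f u) _) ⟩
      ∑[ u ∈ allFin n ] (∑ (allFin n) g * f u)
        ≡⟨ *-distribˡ-∑ (allFin n) (∑ (allFin n) g) f ⟨
      ∑ (allFin n) g * ∑ (allFin n) f
        ≡⟨ *-comm _ (∑ (allFin n) f) ⟩
      ∑ (allFin n) f * ∑ (allFin n) g ∎
      where open ≡-Reasoning

  countFin*countFin≡∑² : ∀ n (P Q : Fin n → Bool) →
    countFin n P * countFin n Q ≡ ∑² n (λ u v → [ P u ∧ Q v ])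
  countFin*countFin≡∑² n P Q = begin
    countFin n P * countFin n Q
      ≡⟨ cong₂ _*_ (countFin≡∑ n P) (countFin≡∑ n Q) ⟩
    ∑[ u ∈ allFin n ] [ P u ] * ∑[ v ∈ allFin n ] [ Q v ]
      ≡⟨ ∑²-product n (λ u → [ P u ]) (λ v → [ Q v ]) ⟨
    ∑² n (λ u v → [ P u ] * [ Q v ])
      ≡⟨ ∑²-cong n (λ u v → [∧]≡[]*[] (P u) (Q v)) ⟨
    ∑² n (λ u v → [ P u ∧ Q v ]) ∎
    where open ≡-Reasoning

  ∑-∑²-comm : ∀ {A : Set} xs n (f : A → Fin n → Fin n → ℕ) →
    ∑[ x ∈ xs ] ∑² n (f x) ≡ ∑² n (λ u v → ∑[ x ∈ xs ] f x u v)
  ∑-∑²-comm xs n f = trans (∑-comm xs (allFin n) (λ x u → ∑ (allFin n) (f x u)))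
                           (∑-cong (allFin n) (λ u → ∑-comm xs (allFin n) (λ x → f x u)))

  length-allSubsets : ∀ n → length (allSubsets n) ≡ 2 ℕ.^ n
  length-allSubsets zero = refl
  length-allSubsets (suc n) = begin
    length (allSubsets (suc n))          ≡⟨ length≡∑1 (allSubsets (suc n)) ⟩
    ∑[ S ∈ allSubsets (suc n) ] 1        ≡⟨ ∑-concatMap _ (allSubsets n) _ ⟩
    ∑[ S ∈ allSubsets n ] (2 * 1)        ≡⟨ *-distribˡ-∑ (allSubsets n) 2 _ ⟨
    2 * ∑[ S ∈ allSubsets n ] 1          ≡⟨ cong (2 *_) (length≡∑1 (allSubsets n)) ⟨
    2 * length (allSubsets n)            ≡⟨ cong (2 *_) (length-allSubsets n) ⟩
    2 ℕ.^ suc n                          ∎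
    where open ≡-Reasoning

  count-subsets-by-coordinate : ∀ n (j : Fin n) (g : Bool → Bool) → [ g false ] + [ g true ] ≡ 1 →
    2 * ∑[ S ∈ allSubsets n ] [ g (S j) ] ≡ 2 ℕ.^ n
  count-subsets-by-coordinate (suc k) Fin.zero g g-balanced = cong (2 *_) (begin
    ∑[ S ∈ allSubsets (suc k) ] [ g (S Fin.zero) ]
      ≡⟨ ∑-concatMap _ (allSubsets k) _ ⟩
    ∑[ S ∈ allSubsets k ] ([ g false ] + ([ g true ] + 0))
      ≡⟨ ∑-cong (allSubsets k) (λ _ → trans (cong ([ g false ] +_) (+-identityʳ _)) g-balanced) ⟩
    ∑[ S ∈ allSubsets k ] 1
      ≡⟨ length≡∑1 (allSubsets k) ⟨
    length (allSubsets k)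
      ≡⟨ length-allSubsets k ⟩
    2 ℕ.^ k ∎)
    where open ≡-Reasoning
  count-subsets-by-coordinate (suc k) (Fin.suc j) g g-balanced = begin
    2 * ∑[ S ∈ allSubsets (suc k) ] [ g (S (Fin.suc j)) ]
      ≡⟨ cong (2 *_) (∑-concatMap _ (allSubsets k) _) ⟩
    2 * ∑[ S ∈ allSubsets k ] (2 * [ g (S j) ])
      ≡⟨ cong (2 *_) (*-distribˡ-∑ (allSubsets k) 2 _) ⟨
    2 * (2 * ∑[ S ∈ allSubsets k ] [ g (S j) ])
      ≡⟨ cong (2 *_) (count-subsets-by-coordinate k j g g-balanced) ⟩
    2 ℕ.^ suc k ∎
    where open ≡-Reasoning

  count-subsets-∋-∌ : ∀ n {u v : Fin n} → u ≢ v →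
    4 * ∑[ S ∈ allSubsets n ] [ S u ∧ not (S v) ] ≡ 2 ℕ.^ n
  count-subsets-∋-∌ (suc k) {Fin.zero} {Fin.zero} u≢v = ⊥-elim (u≢v refl)
  count-subsets-∋-∌ (suc k) {Fin.zero} {Fin.suc j} _ = begin
    4 * ∑[ S ∈ allSubsets (suc k) ] [ S Fin.zero ∧ not (S (Fin.suc j)) ]
      ≡⟨ cong (4 *_) (∑-concatMap _ (allSubsets k) _) ⟩
    4 * ∑[ S ∈ allSubsets k ] ([ not (S j) ] + 0)
      ≡⟨ cong (4 *_) (∑-cong (allSubsets k) (λ S → +-identityʳ _)) ⟩
    4 * N
      ≡⟨ *-assoc 2 2 N ⟩
    2 * (2 * N)
      ≡⟨ cong (2 *_) (count-subsets-by-coordinate k j not refl) ⟩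
    2 ℕ.^ suc k ∎
    where
    open ≡-Reasoning
    N = ∑[ S ∈ allSubsets k ] [ not (S j) ]
  count-subsets-∋-∌ (suc k) {Fin.suc i} {Fin.zero} _ = begin
    4 * ∑[ S ∈ allSubsets (suc k) ] [ S (Fin.suc i) ∧ not (S Fin.zero) ]
      ≡⟨ cong (4 *_) (∑-concatMap _ (allSubsets k) _) ⟩
    4 * ∑[ S ∈ allSubsets k ] ([ S i ∧ true ] + ([ S i ∧ false ] + 0))
      ≡⟨ cong (4 *_) (∑-cong (allSubsets k) (λ S → ∧true+∧false (S i))) ⟩
    4 * N
      ≡⟨ *-assoc 2 2 N ⟩
    2 * (2 * N)
      ≡⟨ cong (2 *_) (count-subsets-by-coordinate k i (λ b → b) refl) ⟩
    2 ℕ.^ suc k ∎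
    where
    open ≡-Reasoning
    N = ∑[ S ∈ allSubsets k ] [ S i ]
    ∧true+∧false : ∀ b → [ b ∧ true ] + ([ b ∧ false ] + 0) ≡ [ b ]
    ∧true+∧false true = refl
    ∧true+∧false false = refl
  count-subsets-∋-∌ (suc k) {Fin.suc i} {Fin.suc j} u≢v = begin
    4 * ∑[ S ∈ allSubsets (suc k) ] [ S (Fin.suc i) ∧ not (S (Fin.suc j)) ]
      ≡⟨ cong (4 *_) (∑-concatMap _ (allSubsets k) _) ⟩
    4 * ∑[ S ∈ allSubsets k ] (2 * [ S i ∧ not (S j) ])
      ≡⟨ cong (4 *_) (*-distribˡ-∑ (allSubsets k) 2 _) ⟨
    4 * (2 * N)
      ≡⟨ trans (sym (*-assoc 4 2 N)) (*-assoc 2 4 N) ⟩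
    2 * (4 * N)
      ≡⟨ cong (2 *_) (count-subsets-∋-∌ k (u≢v ∘ cong Fin.suc)) ⟩
    2 ℕ.^ suc k ∎
    where
    open ≡-Reasoning
    N = ∑[ S ∈ allSubsets k ] [ S i ∧ not (S j) ]

  module _ {n} (G : Graph n) where

    adjacent⇒distinct : ∀ {u v} → adj G u v ≡ true → u ≢ v
    adjacent⇒distinct {u} uv refl with () ← trans (sym uv) (irrefl G u)

    adj-split : ∀ u v → [ adj G u v ] ≡ [ adj G u v ∧ ⌊ u <? v ⌋ ] + [ adj G v u ∧ ⌊ v <? u ⌋ ]
    adj-split u v with u <? v | v <? u
    ... | yes u<v | yes v<u = ⊥-elim (<-asym u<v v<u)
    ... | yes _   | no _    = one-sided (adj G u v) (adj G v u)
    ... | no _    | yes _   = trans (cong [_] (Graph.sym G u v)) (trans (one-sided (adj G v u) (adj G u v))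
                                                                         (+-comm [ adj G v u ∧ true ] _))
    ... | no u≮v  | no v≮u  with refl ← toℕ-injective (≤-antisym (≮⇒≥ v≮u) (≮⇒≥ u≮v))
                            rewrite irrefl G u = refl

    ∑²-adj : ∑² n (λ u v → [ adj G u v ]) ≡ 2 * edges G
    ∑²-adj = begin
      ∑² n (λ u v → [ adj G u v ])
        ≡⟨ ∑²-cong n adj-split ⟩
      ∑² n (λ u v → [ adj G u v ∧ ⌊ u <? v ⌋ ] + [ adj G v u ∧ ⌊ v <? u ⌋ ])
        ≡⟨ ∑²-distrib-+ n _ _ ⟩
      ∑² n forward + ∑² n (λ u v → forward v u)
        ≡⟨ cong (∑² n forward +_) (∑²-transpose n forward) ⟩
      ∑² n forward + ∑² n forward
        ≡⟨ cong₂ _+_ edges≡ edges≡ ⟨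
      edges G + edges G
        ≡⟨ cong (edges G +_) (+-identityʳ (edges G)) ⟨
      2 * edges G ∎
      where
      open ≡-Reasoning
      forward : Fin n → Fin n → ℕ
      forward u v = [ adj G u v ∧ ⌊ u <? v ⌋ ]
      edges≡ : edges G ≡ ∑² n forward
      edges≡ = countPairs≡∑² n _

    handshake : ∑[ v ∈ allFin n ] deg G v ≡ 2 * edges G
    handshake = trans (∑-cong (allFin n) (λ u → countFin≡∑ n (adj G u))) ∑²-adj

    cut : VSet n → ℕ
    cut S = e G S (complement S)

    ∑-cut : 4 * ∑ (allSubsets n) cut ≡ 2 ℕ.^ n * (2 * edges G)
    ∑-cut = begin
      4 * ∑ (allSubsets n) cut
        ≡⟨ cong (4 *_) (∑-cong (allSubsets n) (λ S → countPairs≡∑² n _)) ⟩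
      4 * ∑[ S ∈ allSubsets n ] ∑² n (λ u v → [ adj G u v ∧ S u ∧ not (S v) ])
        ≡⟨ cong (4 *_) (∑-∑²-comm (allSubsets n) n _) ⟩
      4 * ∑² n (λ u v → ∑[ S ∈ allSubsets n ] [ adj G u v ∧ S u ∧ not (S v) ])
        ≡⟨ *-distribˡ-∑² n 4 _ ⟩
      ∑² n (λ u v → 4 * ∑[ S ∈ allSubsets n ] [ adj G u v ∧ S u ∧ not (S v) ])
        ≡⟨ ∑²-cong n edge-cut-by-quarter ⟩
      ∑² n (λ u v → 2 ℕ.^ n * [ adj G u v ])
        ≡⟨ *-distribˡ-∑² n (2 ℕ.^ n) _ ⟨
      2 ℕ.^ n * ∑² n (λ u v → [ adj G u v ])
        ≡⟨ cong (2 ℕ.^ n *_) ∑²-adj ⟩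
      2 ℕ.^ n * (2 * edges G) ∎
      where
      open ≡-Reasoning
      edge-cut-by-quarter : ∀ u v →
        4 * ∑[ S ∈ allSubsets n ] [ adj G u v ∧ S u ∧ not (S v) ] ≡ 2 ℕ.^ n * [ adj G u v ]
      edge-cut-by-quarter u v with adj G u v in uv
      ... | false = trans (cong (4 *_) (∑-zero (allSubsets n))) (sym (*-zeroʳ (2 ℕ.^ n)))
      ... | true = trans (count-subsets-∋-∌ n (adjacent⇒distinct uv)) (sym (*-identityʳ (2 ℕ.^ n)))

    edges≤2*OPT : edges G ≤ 2 * OPT G
    edges≤2*OPT = *-cancelˡ-≤ (2 ℕ.^ n * 2) {{m*n≢0 (2 ℕ.^ n) 2 {{m^n≢0 2 n}}}} (begin
      2 ℕ.^ n * 2 * edges G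
        ≡⟨ *-assoc (2 ℕ.^ n) 2 (edges G) ⟩
      2 ℕ.^ n * (2 * edges G)
        ≡⟨ ∑-cut ⟨
      4 * ∑ (allSubsets n) cut
        ≤⟨ *-monoʳ-≤ 4 (∑≤maximum*length (allSubsets n) cut) ⟩
      4 * (OPT G * length (allSubsets n))
        ≡⟨ cong (λ k → 4 * (OPT G * k)) (length-allSubsets n) ⟩
      4 * (OPT G * 2 ℕ.^ n)
        ≡⟨ rearrange (OPT G) (2 ℕ.^ n) ⟩
      2 ℕ.^ n * 2 * (2 * OPT G) ∎)
      where
      open ≤-Reasoning
      rearrange : ∀ a b → 4 * (a * b) ≡ b * 2 * (2 * a)
      rearrange = solve-∀

    cut≤cut-induced+e+|H|² : ∀ (H S : VSet n) → let L = complement H in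
      cut S ≤ e G (intersect L S) (intersect L (complement S)) + (e G H L + countFin n H * countFin n H)
    cut≤cut-induced+e+|H|² H S = begin
      cut S
        ≡⟨ countPairs≡∑² n _ ⟩
      ∑² n (λ u v → [ adj G u v ∧ S u ∧ not (S v) ])
        ≤⟨ ∑²-mono-≤ n classify ⟩
      ∑² n (λ u v → inside u v + (forward u v + backward v u + both u v))
        ≡⟨ ∑²-distrib-+ n inside _ ⟩
      ∑² n inside + ∑² n (λ u v → forward u v + backward v u + both u v)
        ≡⟨ cong (∑² n inside +_) (∑²-distrib-+ n _ both) ⟩
      ∑² n inside + (∑² n (λ u v → forward u v + backward v u) + ∑² n both)
        ≡⟨ cong (λ x → ∑² n inside + (x + ∑² n both)) (∑²-+-transpose n forward backward) ⟩
      ∑² n inside + (∑² n (λ u v → forward u v + backward u v) + ∑² n both)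
        ≤⟨ +-monoʳ-≤ (∑² n inside) (+-monoˡ-≤ (∑² n both) (∑²-mono-≤ n one-way)) ⟩
      ∑² n inside + (∑² n (λ u v → [ crossing u v ]) + ∑² n both)
        ≡⟨ cong₂ (λ x y → x + (y + ∑² n both)) (countPairs≡∑² n _) (countPairs≡∑² n _) ⟨
      cutL + (e G H L + ∑² n both)
        ≡⟨ cong (λ x → cutL + (e G H L + x)) (countFin*countFin≡∑² n H H) ⟨
      cutL + (e G H L + countFin n H * countFin n H) ∎
      where
      open ≤-Reasoning
      L = complement H
      cutL = e G (intersect L S) (intersect L (complement S))
      crossing : Fin n → Fin n → Bool
      crossing u v = adj G u v ∧ H u ∧ not (H v)
      inside forward backward both : Fin n → Fin n → ℕ
      inside u v = [ adj G u v ∧ (not (H u) ∧ S u) ∧ (not (H v) ∧ not (S v)) ]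
      forward u v = [ crossing u v ∧ (S u ∧ not (S v)) ]
      backward u v = [ crossing u v ∧ (S v ∧ not (S u)) ]
      both u v = [ H u ∧ H v ]

      classify : ∀ u v → [ adj G u v ∧ S u ∧ not (S v) ] ≤ inside u v + (forward u v + backward v u + both u v)
      classify u v rewrite Graph.sym G v u = classify-cut-pair (adj G u v) (H u) (H v) (S u) (S v)

      one-way : ∀ u v → forward u v + backward u v ≤ [ crossing u v ]
      one-way u v = cut-at-most-one-way (crossing u v) (S u) (S v)

    OPT≤OPT-induced+e+|H|² : ∀ (H : VSet n) → let L = complement H in
      OPT G ≤ OPT-induced G L + (e G H L + countFin n H * countFin n H)
    OPT≤OPT-induced+e+|H|² H = maximum-mono-+ (allSubsets n) _ (cut≤cut-induced+e+|H|² H)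

open import Data.Bool.Base using (Bool; true; false; T)
import Data.Integer.Base as ℤ
import Data.Integer.Properties as ℤ
open import Data.List.Base using ([]; _∷_; allFin)
open import Data.Nat as ℕ using (ℕ)
import Data.Nat.Coprimality as Coprime
open import Data.Rational using (ℚ; 0ℚ; 1ℚ; ½; _<_; _≤_; _+_; _-_; _*_)
open import Data.Rational.Base using (mkℚ; _/_; -_; *<*; *≤*; positive; nonNegative; 1/_)
import Data.Rational.Properties as ℚ
open import Relation.Binary.PropositionalEquality
  using (_≡_; sym; trans; cong; cong₂; subst; subst₂)
open import Relation.Nullary.Decidable using (⌊_⌋; toWitness; dec⇒maybe)
open import Tactic.RingSolver using (solve)
open import Tactic.RingSolver.Core.AlmostCommutativeRing using (AlmostCommutativeRing; fromCommutativeRing)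

open Counting using (∑; [_]; countFin≡∑; handshake; edges≤2*OPT; OPT≤OPT-induced+e+|H|²)

-- The zero test lets the solver cancel opposite monomials, as in x + y - y.
ℚ-ring : AlmostCommutativeRing _ _
ℚ-ring = fromCommutativeRing ℚ.+-*-commutativeRing (λ x → dec⇒maybe (0ℚ ℚ.≟ x))

ℕ→ℚ≡mkℚ : ∀ k → ℕ→ℚ k ≡ mkℚ (ℤ.+ k) 0 (Coprime.sym (Coprime.1-coprimeTo k))
ℕ→ℚ≡mkℚ k = ℚ.normalize-coprime (Coprime.sym (Coprime.1-coprimeTo k))

ℕ→ℚ-homo-+ : ∀ a b → ℕ→ℚ (a ℕ.+ b) ≡ ℕ→ℚ a + ℕ→ℚ b
ℕ→ℚ-homo-+ a b rewrite ℕ→ℚ≡mkℚ a | ℕ→ℚ≡mkℚ b =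
  sym (cong₂ (λ x y → (x ℤ.+ y) / 1) (ℤ.*-identityʳ (ℤ.+ a)) (ℤ.*-identityʳ (ℤ.+ b)))

ℕ→ℚ-homo-* : ∀ a b → ℕ→ℚ (a ℕ.* b) ≡ ℕ→ℚ a * ℕ→ℚ b
ℕ→ℚ-homo-* a b rewrite ℕ→ℚ≡mkℚ a | ℕ→ℚ≡mkℚ b = cong (_/ 1) (ℤ.pos-* a b)

ℕ→ℚ-mono-≤ : ∀ {a b} → a ℕ.≤ b → ℕ→ℚ a ≤ ℕ→ℚ b
ℕ→ℚ-mono-≤ {a} {b} a≤b rewrite ℕ→ℚ≡mkℚ a | ℕ→ℚ≡mkℚ b =
  *≤* (subst₂ ℤ._≤_ (sym (ℤ.*-identityʳ (ℤ.+ a))) (sym (ℤ.*-identityʳ (ℤ.+ b))) (ℤ.+≤+ a≤b))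

ℕ→ℚ-mono-< : ∀ {a b} → a ℕ.< b → ℕ→ℚ a < ℕ→ℚ b
ℕ→ℚ-mono-< {a} {b} a<b rewrite ℕ→ℚ≡mkℚ a | ℕ→ℚ≡mkℚ b =
  *<* (subst₂ ℤ._<_ (sym (ℤ.*-identityʳ (ℤ.+ a))) (sym (ℤ.*-identityʳ (ℤ.+ b))) (ℤ.+<+ a<b))

ℕ→ℚ-nonNeg : ∀ k → 0ℚ ≤ ℕ→ℚ k
ℕ→ℚ-nonNeg k = ℕ→ℚ-mono-≤ {0} {k} ℕ.z≤n

p/'q*q≡p : ∀ p {q} → 0ℚ < q → (p /' q) * q ≡ p
p/'q*q≡p p {mkℚ (ℤ.+ 0) _ _} (*<* (ℤ.+<+ ()))
p/'q*q≡p p {q@(mkℚ ℤ.+[1+ _ ] _ _)} _ =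
  trans (ℚ.*-assoc p (1/ q) q) (trans (cong (p *_) (ℚ.*-inverseˡ q)) (ℚ.*-identityʳ p))

/'-pos : ∀ {p q} → 0ℚ < p → 0ℚ < q → 0ℚ < p /' q
/'-pos {p} {q} 0<p 0<q = ℚ.*-cancelʳ-<-nonNeg q {{nonNegative (ℚ.<⇒≤ 0<q)}}
  (subst₂ _<_ (sym (ℚ.*-zeroˡ q)) (sym (p/'q*q≡p p 0<q)) 0<p)

p/'q<r⇒p<r*q : ∀ {p q r} → 0ℚ < q → p /' q < r → p < r * q
p/'q<r⇒p<r*q {p} {q} 0<q p/q<r =
  subst (_< _) (p/'q*q≡p p 0<q) (ℚ.*-monoˡ-<-pos q {{positive 0<q}} p/q<r)

^-+ : ∀ x j k → x ^ (j ℕ.+ k) ≡ x ^ j * x ^ k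
^-+ x ℕ.zero k = sym (ℚ.*-identityˡ (x ^ k))
^-+ x (ℕ.suc j) k = trans (cong (x *_) (^-+ x j k)) (sym (ℚ.*-assoc x (x ^ j) (x ^ k)))

^-2 : ∀ x → x ^ 2 ≡ x * x
^-2 x = cong (x *_) (ℚ.*-identityʳ x)

*-pos : ∀ {p q} → 0ℚ < p → 0ℚ < q → 0ℚ < p * q
*-pos {p} {q} 0<p 0<q = ℚ.positive⁻¹ (p * q) {{ℚ.pos*pos⇒pos p {{positive 0<p}} q {{positive 0<q}}}}

*-nonNeg : ∀ {p q} → 0ℚ ≤ p → 0ℚ ≤ q → 0ℚ ≤ p * q
*-nonNeg {p} {q} 0≤p 0≤q =
  ℚ.nonNegative⁻¹ (p * q) {{ℚ.nonNeg*nonNeg⇒nonNeg p {{nonNegative 0≤p}} q {{nonNegative 0≤q}}}}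

^-pos : ∀ {x} k → 0ℚ < x → 0ℚ < x ^ k
^-pos ℕ.zero 0<x = ℕ→ℚ-mono-< {0} {1} (ℕ.s≤s ℕ.z≤n)
^-pos (ℕ.suc k) 0<x = *-pos 0<x (^-pos k 0<x)

count*threshold≤∑ : ∀ {A : Set} xs (P : A → Bool) (D : A → ℕ) t → (∀ x → T (P x) → t ≤ ℕ→ℚ (D x)) →
  ℕ→ℚ (∑[ x ∈ xs ] [ P x ]) * t ≤ ℕ→ℚ (∑ xs D)
count*threshold≤∑ [] P D t _ = ℚ.≤-reflexive (ℚ.*-zeroˡ t)
count*threshold≤∑ (x ∷ xs) P D t P⇒t≤D = begin
  ℕ→ℚ ([ P x ] ℕ.+ ∑[ y ∈ xs ] [ P y ]) * t
    ≡⟨ cong (_* t) (ℕ→ℚ-homo-+ [ P x ] _) ⟩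
  (ℕ→ℚ [ P x ] + ℕ→ℚ (∑[ y ∈ xs ] [ P y ])) * t
    ≡⟨ ℚ.*-distribʳ-+ t (ℕ→ℚ [ P x ]) _ ⟩
  ℕ→ℚ [ P x ] * t + ℕ→ℚ (∑[ y ∈ xs ] [ P y ]) * t
    ≤⟨ ℚ.+-mono-≤ (head-bound (P x) (P⇒t≤D x)) (count*threshold≤∑ xs P D t P⇒t≤D) ⟩
  ℕ→ℚ (D x) + ℕ→ℚ (∑ xs D)
    ≡⟨ ℕ→ℚ-homo-+ (D x) _ ⟨
  ℕ→ℚ (D x ℕ.+ ∑ xs D) ∎
  where
  open ℚ.≤-Reasoning
  head-bound : ∀ b → (T b → t ≤ ℕ→ℚ (D x)) → ℕ→ℚ [ b ] * t ≤ ℕ→ℚ (D x)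
  head-bound true t≤D = subst (_≤ ℕ→ℚ (D x)) (sym (ℚ.*-identityˡ t)) (t≤D _)
  head-bound false _ = subst (_≤ ℕ→ℚ (D x)) (sym (ℚ.*-zeroˡ t)) (ℕ→ℚ-nonNeg (D x))

|heavy|*threshold≤2m : ∀ {n} (G : Graph n) t → let heavy = λ v → ⌊ t ℚ.≤? ℕ→ℚ (deg G v) ⌋ in
  ℕ→ℚ (countFin n heavy) * t ≤ ℕ→ℚ 2 * ℕ→ℚ (edges G)
|heavy|*threshold≤2m {n} G t = begin
  ℕ→ℚ (countFin n heavy) * t
    ≡⟨ cong (λ k → ℕ→ℚ k * t) (countFin≡∑ n heavy) ⟩
  ℕ→ℚ (∑[ v ∈ allFin n ] [ heavy v ]) * t
    ≤⟨ count*threshold≤∑ (allFin n) heavy (deg G) t (λ v → toWitness {a? = t ℚ.≤? ℕ→ℚ (deg G v)}) ⟩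
  ℕ→ℚ (∑[ v ∈ allFin n ] deg G v)
    ≡⟨ cong ℕ→ℚ (handshake G) ⟩
  ℕ→ℚ (2 ℕ.* edges G)
    ≡⟨ ℕ→ℚ-homo-* 2 (edges G) ⟩
  ℕ→ℚ 2 * ℕ→ℚ (edges G) ∎
  where
  open ℚ.≤-Reasoning
  heavy = λ v → ⌊ t ℚ.≤? ℕ→ℚ (deg G v) ⌋

threshold-cancel : ∀ {h w m c k} → 0ℚ < c → 0ℚ < m → h * ((w * m) /' c) ≤ k * m → h * w ≤ k * c
threshold-cancel {h} {w} {m} {c} {k} 0<c 0<m h*t≤k*m = ℚ.*-cancelʳ-≤-pos m {{positive 0<m}} (begin
  h * w * m                ≡⟨ ℚ.*-assoc h w m ⟩
  h * (w * m)              ≡⟨ cong (h *_) (p/'q*q≡p (w * m) 0<c) ⟨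
  h * ((w * m) /' c * c)   ≡⟨ ℚ.*-assoc h _ c ⟨
  h * ((w * m) /' c) * c   ≤⟨ ℚ.*-monoʳ-≤-nonNeg c {{nonNegative (ℚ.<⇒≤ 0<c)}} h*t≤k*m ⟩
  k * m * c                ≡⟨ solve (k ∷ m ∷ c ∷ []) ℚ-ring ⟩
  k * c * m                ∎)
  where open ℚ.≤-Reasoning

square-mono-≤ : ∀ {a b} → 0ℚ ≤ a → a ≤ b → a * a ≤ b * b
square-mono-≤ {a} {b} 0≤a a≤b = ℚ.≤-trans
  (ℚ.*-monoˡ-≤-nonNeg a {{nonNegative 0≤a}} a≤b)
  (ℚ.*-monoʳ-≤-nonNeg b {{nonNegative (ℚ.≤-trans 0≤a a≤b)}} a≤b)

square-of-heavy-count< : ∀ {h E c m o} → 0ℚ < E → 0ℚ ≤ h → h * E ≤ ℕ→ℚ 2 * c →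
  ℕ→ℚ 8 * (c * c) < m * ((E * E) * (E * E)) → m ≤ ℕ→ℚ 2 * o → h * h < o * (E * E)
square-of-heavy-count< {h} {E} {c} {m} {o} 0<E 0≤h hE≤2c 8c²<mE⁴ m≤2o =
  ℚ.*-cancelʳ-<-nonNeg (E * E) {{nonNegative (ℚ.<⇒≤ 0<E²)}}
    (ℚ.*-cancelʳ-<-nonNeg (ℕ→ℚ 2) {{nonNegative (ℕ→ℚ-nonNeg 2)}} (begin-strict
      h * h * (E * E) * ℕ→ℚ 2
        ≡⟨ solve (h ∷ E ∷ []) ℚ-ring ⟩
      ℕ→ℚ 2 * ((h * E) * (h * E))
        ≤⟨ ℚ.*-monoˡ-≤-nonNeg (ℕ→ℚ 2) {{nonNegative (ℕ→ℚ-nonNeg 2)}}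
             (square-mono-≤ (*-nonNeg 0≤h (ℚ.<⇒≤ 0<E)) hE≤2c) ⟩
      ℕ→ℚ 2 * ((ℕ→ℚ 2 * c) * (ℕ→ℚ 2 * c))
        ≡⟨ solve (c ∷ []) ℚ-ring ⟩
      ℕ→ℚ 8 * (c * c)
        <⟨ 8c²<mE⁴ ⟩
      m * ((E * E) * (E * E))
        ≤⟨ ℚ.*-monoʳ-≤-nonNeg _ {{nonNegative (ℚ.<⇒≤ (*-pos 0<E² 0<E²))}} m≤2o ⟩
      ℕ→ℚ 2 * o * ((E * E) * (E * E))
        ≡⟨ solve (o ∷ E ∷ []) ℚ-ring ⟩
      o * (E * E) * (E * E) * ℕ→ℚ 2 ∎))
  where
  open ℚ.≤-Reasoning
  0<E² : 0ℚ < E * E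
  0<E² = *-pos 0<E 0<E

square-of-heavy-count<ε⁴ : ∀ {h ε c m o} → 0ℚ < ε → 0ℚ ≤ h → h * ε ^ 2 ≤ ℕ→ℚ 2 * c →
  (ℕ→ℚ 8 * c ^ 2) /' (ε ^ 8) < m → m ≤ ℕ→ℚ 2 * o → h * h < o * ε ^ 4
square-of-heavy-count<ε⁴ {h} {ε} {c} {m} {o} 0<ε 0≤h hε²≤2c 8c²/ε⁸<m m≤2o =
  subst (λ x → h * h < o * x) (sym ε⁴≡ε²ε²)
    (square-of-heavy-count< {h} {ε ^ 2} {c} {m} {o} (^-pos 2 0<ε) 0≤h hε²≤2c 8c²<mε⁸ m≤2o)
  where
  ε⁴≡ε²ε² : ε ^ 4 ≡ ε ^ 2 * ε ^ 2
  ε⁴≡ε²ε² = ^-+ ε 2 2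
  8c²<mε⁸ : ℕ→ℚ 8 * (c * c) < m * ((ε ^ 2 * ε ^ 2) * (ε ^ 2 * ε ^ 2))
  8c²<mε⁸ = subst₂ _<_ (cong (ℕ→ℚ 8 *_) (^-2 c))
    (cong (m *_) (trans (^-+ ε 4 4) (cong₂ _*_ ε⁴≡ε²ε² ε⁴≡ε²ε²)))
    (p/'q<r⇒p<r*q (^-pos 8 0<ε) 8c²/ε⁸<m)

rearrange-split-bound : ∀ {o l a s F} → o ≤ l + (a * o + s) → s < o * F → ((1ℚ - a) - F) * o < l
rearrange-split-bound {o} {l} {a} {s} {F} o≤l+ao+s s<oF = begin-strict
  ((1ℚ - a) - F) * o
    ≡⟨ solve (o ∷ a ∷ F ∷ []) ℚ-ring ⟩
  o - (a * o + o * F)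
    <⟨ ℚ.+-monoˡ-< (- (a * o + o * F)) o<l+ao+oF ⟩
  l + (a * o + o * F) - (a * o + o * F)
    ≡⟨ solve (o ∷ l ∷ a ∷ F ∷ []) ℚ-ring ⟩
  l ∎
  where
  open ℚ.≤-Reasoning
  o<l+ao+oF : o < l + (a * o + o * F)
  o<l+ao+oF = ℚ.≤-<-trans o≤l+ao+s (ℚ.+-monoʳ-< l (ℚ.+-monoʳ-< (a * o) s<oF))

mainTheorem5 : ∀ {n : ℕ} (G : Graph n) (ε δ α : ℚ) →
    0ℚ < ε → ε ≤ ½ → 0ℚ < δ → δ < 1ℚ → 1 ℕ.≤ edges G →
    let m = ℕ→ℚ (edges G)
        c = ℕ→ℚ 80 /' δ
        H = H-set G ε c
        L = complement H
        opt = ℕ→ℚ (OPT G)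
    in ℕ→ℚ (e G H L) ≡ α * opt →
       α < ½ + (ε ^ 2) →
       (ℕ→ℚ 8 * (c ^ 2)) /' (ε ^ 8) < m →
       ((1ℚ - α) - (ε ^ 4)) * opt < ℕ→ℚ (OPT-induced G L)
mainTheorem5 {n} G ε δ α 0<ε _ 0<δ _ 1≤edges e≡α*opt _ 8c²/ε⁸<m =
  rearrange-split-bound {a = α} opt≤optL+α*opt+h² h²<opt*ε⁴
  where
  m = ℕ→ℚ (edges G)
  c = ℕ→ℚ 80 /' δ
  H = H-set G ε c
  L = complement H
  opt = ℕ→ℚ (OPT G)
  optL = ℕ→ℚ (OPT-induced G L)
  h = ℕ→ℚ (countFin n H)

  hε²≤2c : h * ε ^ 2 ≤ ℕ→ℚ 2 * c
  hε²≤2c = threshold-cancel {h} {ε ^ 2} {m} {c} {ℕ→ℚ 2}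
    (/'-pos (ℕ→ℚ-mono-< {0} {80} (ℕ.s≤s ℕ.z≤n)) 0<δ) (ℕ→ℚ-mono-< 1≤edges)
    (|heavy|*threshold≤2m G ((ε ^ 2 * m) /' c))

  m≤2opt : m ≤ ℕ→ℚ 2 * opt
  m≤2opt = subst (m ≤_) (ℕ→ℚ-homo-* 2 (OPT G)) (ℕ→ℚ-mono-≤ (edges≤2*OPT G))

  h²<opt*ε⁴ : h * h < opt * ε ^ 4
  h²<opt*ε⁴ = square-of-heavy-count<ε⁴ {h} {ε} {c} {m} {opt}
    0<ε (ℕ→ℚ-nonNeg (countFin n H)) hε²≤2c 8c²/ε⁸<m m≤2opt

  opt≤optL+α*opt+h² : opt ≤ optL + (α * opt + h * h)
  opt≤optL+α*opt+h² = subst (opt ≤_)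
    (trans (ℕ→ℚ-homo-+ (OPT-induced G L) _) (cong (optL +_)
      (trans (ℕ→ℚ-homo-+ (e G H L) _) (cong₂ _+_ e≡α*opt (ℕ→ℚ-homo-* (countFin n H) _)))))
    (ℕ→ℚ-mono-≤ (OPT≤OPT-induced+e+|H|² G H))
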